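{- Let $A$ be a set and $W$ a set of subsets of $A$ which is closed under pairwise unions and intersections and contains $\emptyset$ and $A$. Suppose that no subset $C\subseteq A\times A$ all of whose rows $\{b\mid (a,b)\in C\}$ and columns $\{b\mid (b,a)\in C\}$ $(a\in A)$ lie in $W$ has infinitely many distinct rows. Then $(A,W)$ is a Pratt comonoid.
   Context: A Pratt comonoid is a pair $(A,W)$ with $A$ a set and $W$ a set of subsets of $A$ such that (i) $\emptyset\in W$ and $A\in W$; (ii) whenever $C\subseteq A\times A$ is such that for every $a\in A$ both the row $\{b\mid (a,b)\in C\}$ and the column $\{b\mid (b,a)\in C\}$ belong to $W$, the diagonal $\{b\mid (b,b)\in C\}$ also belongs to $W$. -}

module Defs where

open import Level using (Level; suc; _⊔_)
open import Data.Bool using (Bool; true; false; _∧_; _∨_)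
open import Data.Nat using (ℕ)
open import Data.Product using (Σ; _×_)
open import Relation.Binary.PropositionalEquality using (_≡_; _≢_)
open import Relation.Nullary using (¬_)

-- A subset of A, represented by its (classical) characteristic function.
Subset : ∀ {a} → Set a → Set a
Subset A = A → Bool

_≐_ : ∀ {a} {A : Set a} → Subset A → Subset A → Set a
S ≐ T = ∀ x → S x ≡ T x

∅ : ∀ {a} {A : Set a} → Subset A
∅ _ = false

full : ∀ {a} {A : Set a} → Subset A
full _ = true

_∪_ : ∀ {a} {A : Set a} → Subset A → Subset A → Subset A
(S ∪ T) x = S x ∨ T x

_∩_ : ∀ {a} {A : Set a} → Subset A → Subset A → Subset A
(S ∩ T) x = S x ∧ T x

Family : ∀ {a} → Set a → (w : Level) → Set (a ⊔ suc w)
Family A w = Subset A → Set w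

-- W is a genuine set of subsets: membership respects equality of subsets.
Extensional : ∀ {a w} {A : Set a} → Family A w → Set (a ⊔ w)
Extensional {A = A} W = ∀ (S T : Subset A) → S ≐ T → W S → W T

row : ∀ {a} {A : Set a} → (A → A → Bool) → A → Subset A
row C x b = C x b

col : ∀ {a} {A : Set a} → (A → A → Bool) → A → Subset A
col C x b = C b x

diag : ∀ {a} {A : Set a} → (A → A → Bool) → Subset A
diag C b = C b b

RowsColsIn : ∀ {a w} {A : Set a} → Family A w → (A → A → Bool) → Set (a ⊔ w)
RowsColsIn W C = ∀ x → W (row C x) × W (col C x)

InfinitelyManyDistinctRows : ∀ {a} {A : Set a} → (A → A → Bool) → Set a
InfinitelyManyDistinctRows {A = A} C =
  Σ (ℕ → A) λ f → ∀ i j → i ≢ j → ¬ (row C (f i) ≐ row C (f j))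

IsPrattComonoid : ∀ {a w} (A : Set a) → Family A w → Set (a ⊔ w)
IsPrattComonoid A W =
  W ∅ × W full × (∀ (C : A → A → Bool) → RowsColsIn W C → W (diag C))

-- Let L be a list of representatives of the rows of C and M one of its columns; both
-- exist because C has only finitely many distinct rows and columns (a greedy choice of
-- ever new rows would otherwise produce infinitely many). Then
--   diag C = ⋃_{y ∈ L} (row y ∩ ⋂_{m ∈ M, C y m} col m),
-- a finite lattice combination of rows and columns: if x lies in the right-hand side via
-- y, pick m ∈ M with col m = col x; then C y m holds, so C x m, i.e. C x x. Conversely
-- for C x x take y ∈ L with row y = row x.
module Submission where

open import Level using (Level; _⊔_)
open import Data.Bool using (Bool; T; if_then_else_; true; false)
open import Data.Bool.Properties using (T-≡; T-∧; ⇔→≡)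
open import Data.List using (List; []; _∷_)
open import Data.Bool.ListAction using (any; all)
open import Data.List.Membership.Propositional using (_∈_; lose)
open import Data.List.Relation.Unary.Any as Any using (Any; here; there)
open import Data.List.Relation.Unary.Any.Properties using (any⁺; any⁻)
open import Data.List.Relation.Unary.All as All using (All)
open import Data.List.Relation.Unary.All.Properties using (all⁺; all⁻)
open import Data.Nat using (ℕ; zero; suc; _<_)
open import Data.Nat.Properties using (<-cmp; m<1+n⇒m<n∨m≡n)
open import Data.Product using (Σ; ∃; _,_; proj₁; proj₂; swap)
open import Data.Sum using (inj₁; inj₂)
open import Function using (_∘_; flip; _⇔_; mk⇔; Equivalence)
import Function.Properties.Equivalence as ⇔
open import Relation.Binary using (Rel; Symmetric; tri<; tri≈; tri>)
open import Relation.Binary.PropositionalEquality using (_≡_; _≢_; refl; sym; subst)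
open import Relation.Nullary using (¬_)
open import Relation.Nullary.Decidable using (decidable-stable)
open import Axiom.ExcludedMiddle using (ExcludedMiddle)
open import Defs

private
  variable
    a i w : Level
    A : Set a
    I : Set i

T⇔T⇒≡ : ∀ {x y} → T x ⇔ T y → x ≡ y
T⇔T⇒≡ x⇔y = ⇔→≡ (⇔.trans (⇔.sym T-≡) (⇔.trans x⇔y T-≡))

¬∀⇒∃¬ : ∀ {ℓ} {A : Set ℓ} {P : A → Set ℓ} → ExcludedMiddle ℓ →
        ¬ (∀ x → P x) → ∃ λ x → ¬ P x
¬∀⇒∃¬ lem ¬∀P = decidable-stable lem λ ¬∃¬P →
  ¬∀P λ x → decidable-stable lem λ ¬Px → ¬∃¬P (x , ¬Px)

module FiniteCovering {ℓ} {A : Set ℓ} (_∼_ : Rel A ℓ) (∼-sym : Symmetric _∼_) where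

  Separated : (ℕ → A) → Set ℓ
  Separated f = ∀ i j → i ≢ j → ¬ f i ∼ f j

  Covering : List A → Set ℓ
  Covering L = ∀ x → Any (x ∼_) L

  module Greedy (lem : ExcludedMiddle ℓ) (noCovering : ¬ Σ (List A) Covering) where

    uncovered : (L : List A) → ∃ λ x → ¬ Any (x ∼_) L
    uncovered L = ¬∀⇒∃¬ lem λ covering → noCovering (L , covering)

    chosen : ℕ → List A
    next : ℕ → A
    chosen zero = []
    chosen (suc n) = next n ∷ chosen n
    next n = proj₁ (uncovered (chosen n))

    next-fresh : ∀ n → ¬ Any (next n ∼_) (chosen n)
    next-fresh n = proj₂ (uncovered (chosen n))

    next∈chosen : ∀ {i j} → i < j → next i ∈ chosen j
    next∈chosen {i} {suc j} i<1+j with m<1+n⇒m<n∨m≡n i<1+j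
    ... | inj₁ i<j = there (next∈chosen i<j)
    ... | inj₂ refl = here refl

    next-separated : Separated next
    next-separated i j i≢j nextᵢ∼nextⱼ with <-cmp i j
    ... | tri< i<j _ _ = next-fresh j (lose (next∈chosen i<j) (∼-sym nextᵢ∼nextⱼ))
    ... | tri≈ _ i≡j _ = i≢j i≡j
    ... | tri> _ _ j<i = next-fresh i (lose (next∈chosen j<i) nextᵢ∼nextⱼ)

  ¬separated⇒covering : ExcludedMiddle ℓ → ¬ Σ (ℕ → A) Separated → Σ (List A) Covering
  ¬separated⇒covering lem ¬separated = decidable-stable lem λ noCovering →
    ¬separated (Greedy.next lem noCovering , Greedy.next-separated lem noCovering)

⋃ : List I → (I → Subset A) → Subset A
⋃ is S x = any (λ i → S i x) is

⋂ : List I → (I → Subset A) → Subset A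
⋂ is S x = all (λ i → S i x) is

syntax ⋃ is (λ i → S) = ⋃[ i ∈ is ] S
syntax ⋂ is (λ i → S) = ⋂[ i ∈ is ] S

ClosedUnder : ∀ {a w} {A : Set a} → (Subset A → Subset A → Subset A) → Family A w → Set (a ⊔ w)
ClosedUnder _∙_ W = ∀ S T → W S → W T → W (S ∙ T)

module _ (W : Family A w) where

  ⋃-closed : W ∅ → ClosedUnder _∪_ W → ∀ is (S : I → Subset A) → (∀ i → W (S i)) → W (⋃ is S)
  ⋃-closed W∅ ∪-closed [] S WS = W∅
  ⋃-closed W∅ ∪-closed (i ∷ is) S WS = ∪-closed _ _ (WS i) (⋃-closed W∅ ∪-closed is S WS)

  ⋂-closed : W full → ClosedUnder _∩_ W → ∀ is (S : I → Subset A) → (∀ i → W (S i)) → W (⋂ is S)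
  ⋂-closed Wfull ∩-closed [] S WS = Wfull
  ⋂-closed Wfull ∩-closed (i ∷ is) S WS = ∩-closed _ _ (WS i) (⋂-closed Wfull ∩-closed is S WS)

  if-full-closed : W full → ∀ b {S} → W S → W (if b then S else full)
  if-full-closed Wfull true WS = WS
  if-full-closed Wfull false WS = Wfull

if-full-elim : ∀ b {S : Subset A} {x} → T ((if b then S else full) x) → T b → T (S x)
if-full-elim true x∈S _ = x∈S

if-full-intro : ∀ b {S : Subset A} {x} → (T b → T (S x)) → T ((if b then S else full) x)
if-full-intro true x∈S = x∈S _
if-full-intro false _ = _

SameRow SameCol : ∀ {a} {A : Set a} → (A → A → Bool) → Rel A a
SameRow C x y = row C x ≐ row C y
SameCol C x y = col C x ≐ col C y

≐-sym : Symmetric (_≐_ {A = A})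
≐-sym S≐T x = sym (S≐T x)

module _ (C : A → A → Bool) (L M : List A) where

  diagPiece : A → Subset A
  diagPiece y = row C y ∩ (⋂[ m ∈ M ] (if C y m then col C m else full))

  diagFormula : Subset A
  diagFormula = ⋃[ y ∈ L ] diagPiece y

  diag≐diagFormula : (∀ x → Any (SameRow C x) L) → (∀ x → Any (SameCol C x) M) →
                     diag C ≐ diagFormula
  diag≐diagFormula rowReps colReps x = T⇔T⇒≡ (mk⇔ fromDiag toDiag)
    where
    fromDiag : T (C x x) → T (diagFormula x)
    fromDiag Cxx = any⁺ _ (Any.map inPiece (rowReps x))
      where
      inPiece : ∀ {y} → SameRow C x y → T (diagPiece y x)
      inPiece {y} x≐y = Equivalence.from T-∧ (subst T (x≐y x) Cxx ,
        all⁻ _ (All.universal (λ m → if-full-intro (C y m) (subst T (sym (x≐y m)))) M))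

    toDiag : T (diagFormula x) → T (C x x)
    toDiag x∈formula =
      let y , x∈piece = Any.satisfied (any⁻ _ L x∈formula)
          Cyx , x∈⋂ = Equivalence.to T-∧ x∈piece
          m = Any.lookup (colReps x)
          x∈guard , x≐m = All.lookupAny (all⁺ _ M x∈⋂) (colReps x)
          Cym = subst T (x≐m y) Cyx
      in subst T (sym (x≐m x)) (if-full-elim (C y m) x∈guard Cym)

diagFormula-closed : (W : Family A w) → W ∅ → W full → ClosedUnder _∪_ W → ClosedUnder _∩_ W →
                     (C : A → A → Bool) → RowsColsIn W C → ∀ L M → W (diagFormula C L M)
diagFormula-closed W W∅ Wfull ∪-closed ∩-closed C rowsCols L M =
  ⋃-closed W W∅ ∪-closed L _ λ y → ∩-closed _ _ (proj₁ (rowsCols y))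
    (⋂-closed W Wfull ∩-closed M _ λ m → if-full-closed W Wfull (C y m) (proj₂ (rowsCols m)))

corollary5p4 : ∀ {ℓ} → ExcludedMiddle ℓ →
    (A : Set ℓ) (W : Family A ℓ) → Extensional W →
    (∀ S T → W S → W T → W (S ∪ T)) →
    (∀ S T → W S → W T → W (S ∩ T)) →
    W ∅ → W full →
    (∀ (C : A → A → Bool) → RowsColsIn W C → ¬ InfinitelyManyDistinctRows C) →
    IsPrattComonoid A W
corollary5p4 lem A W ext ∪-closed ∩-closed W∅ Wfull finitelyManyRows =
  W∅ , Wfull , λ C rowsCols →
    let open FiniteCovering
        L , rowReps = ¬separated⇒covering (SameRow C) ≐-sym lem (finitelyManyRows C rowsCols)
        M , colReps = ¬separated⇒covering (SameCol C) ≐-sym lem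
                        (finitelyManyRows (flip C) (swap ∘ rowsCols))
    in ext _ _ (≐-sym (diag≐diagFormula C L M rowReps colReps))
         (diagFormula-closed W W∅ Wfull ∪-closed ∩-closed C rowsCols L M)
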